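{- Let $m_1, l_2, m_2, n$ be positive integers with $m_1 < l_2 \leq m_2$. Define \[ \Psi(m_1,l_2,m_2,n) = \#\{X \subseteq [1,m_1]\cup[l_2,m_2] : l_2 \in X \text{ and } \gcd(X\cup\{n\}) = 1\}, \] and for a positive integer $k$, \[ \Psi_k(m_1,l_2,m_2,n) = \#\{X \subseteq [1,m_1]\cup[l_2,m_2] : l_2 \in X,\ \#X = k, \text{ and } \gcd(X\cup\{n\}) = 1\}. \] Then (a) $\displaystyle \Psi(m_1,l_2,m_2,n) = \sum_{d \mid \gcd(l_2,n)} \mu(d)\, 2^{\lfloor m_1/d\rfloor + \lfloor m_2/d\rfloor - l_2/d}$; (b) $\displaystyle \Psi_k(m_1,l_2,m_2,n) = \sum_{d \mid \gcd(l_2,n)} \mu(d) \binom{\lfloor m_1/d\rfloor + \lfloor m_2/d\rfloor - l_2/d}{k-1}$.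
   Context: For integers $a \leq b$, $[a,b] = \{a, a+1, \ldots, b\}$. $\mu$ denotes the Möbius function and $\lfloor x\rfloor$ the floor of $x$. The sums run over positive divisors $d$. -}

module Defs where

open import Data.Nat using (ℕ; zero; suc; _+_; _*_; _∸_; _≟_)
open import Data.Nat.DivMod using (_/_)
open import Data.Nat.Divisibility using (_∣_; _∣?_)
open import Data.Nat.GCD using (gcd)
open import Data.Nat.Primality using (Prime; prime?)
open import Data.Integer using (ℤ; +_; -_) renaming (_+_ to _+ℤ_)
open import Data.List using (List; []; _∷_; map; upTo; filter; length; foldr; _++_)
open import Data.List.Membership.DecPropositional _≟_ using (_∈_; _∈?_)
open import Data.Product using (_×_)
open import Relation.Binary.PropositionalEquality using (_≡_)
open import Relation.Nullary using (Dec; yes; no; ¬_; ¬?)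
open import Relation.Nullary.Decidable using (_×-dec_)
open import Data.List.Relation.Unary.All using (All; all?)

interval : ℕ → ℕ → List ℕ
interval a b = map (λ i → a + i) (upTo (suc b ∸ a))

-- all sublists of a list; for a list of distinct elements these are
-- exactly the subsets, each listed once
sublists : {A : Set} → List A → List (List A)
sublists []       = [] ∷ []
sublists (x ∷ xs) = sublists xs ++ map (x ∷_) (sublists xs)

gcdWith : List ℕ → ℕ → ℕ
gcdWith X n = foldr gcd n X

-- natural division, total (the value at divisor 0 is never used)
_div_ : ℕ → ℕ → ℕ
m div zero    = 0
m div (suc d) = m / suc d

divisors : ℕ → List ℕ
divisors g = filter (λ d → d ∣? g) (interval 1 g)

primeDivisors : ℕ → List ℕ
primeDivisors d = filter (λ p → prime? p ×-dec p ∣? d) (interval 1 d)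

SquareFree : ℕ → Set
SquareFree d = All (λ p → ¬ (p * p ∣ d)) (primeDivisors d)

squareFree? : (d : ℕ) → Dec (SquareFree d)
squareFree? d = all? (λ p → ¬? ((p * p) ∣? d)) (primeDivisors d)

neg1^ : ℕ → ℤ
neg1^ zero    = + 1
neg1^ (suc k) = - neg1^ k

μ : ℕ → ℤ
μ d with squareFree? d
... | yes _ = neg1^ (length (primeDivisors d))
... | no  _ = + 0

sumℤ : List ℤ → ℤ
sumℤ = foldr _+ℤ_ (+ 0)

divisorSum : ℕ → (ℕ → ℤ) → ℤ
divisorSum g f = sumℤ (map f (divisors g))

ground : ℕ → ℕ → ℕ → List ℕ
ground m₁ l₂ m₂ = interval 1 m₁ ++ interval l₂ m₂

Good : ℕ → ℕ → List ℕ → Set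
Good l₂ n X = l₂ ∈ X × gcdWith X n ≡ 1

good? : (l₂ n : ℕ) → (X : List ℕ) → Dec (Good l₂ n X)
good? l₂ n X = (l₂ ∈? X) ×-dec (gcdWith X n ≟ 1)

GoodK : ℕ → ℕ → ℕ → List ℕ → Set
GoodK l₂ n k X = Good l₂ n X × length X ≡ k

goodK? : (l₂ n k : ℕ) → (X : List ℕ) → Dec (GoodK l₂ n k X)
goodK? l₂ n k X = good? l₂ n X ×-dec (length X ≟ k)

Ψ : ℕ → ℕ → ℕ → ℕ → ℕ
Ψ m₁ l₂ m₂ n = length (filter (good? l₂ n) (sublists (ground m₁ l₂ m₂)))

Ψk : ℕ → ℕ → ℕ → ℕ → ℕ → ℕ
Ψk k m₁ l₂ m₂ n = length (filter (goodK? l₂ n k) (sublists (ground m₁ l₂ m₂)))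

{-# OPTIONS --safe #-}
module Submission where

-- Möbius inversion turns the condition gcd(X ∪ {n}) = 1 into Σ_{d ∣ gcd(X ∪ {n})} μ(d); since
-- l₂ ∈ X, every such d divides gcd(l₂, n).  Exchanging the sums, the coefficient of μ(d) counts
-- the sets X ∋ l₂ whose elements are all multiples of d; removing l₂, these are arbitrary subsets
-- of the c = ⌊m₁/d⌋ + ⌊m₂/d⌋ − l₂/d multiples of d in [1, m₁] ∪ (l₂, m₂]: 2^c in all, C(c, k − 1)
-- of size k − 1.

open import Defs
open import Algebra.Properties.CommutativeSemigroup using (interchange)
open import Data.Empty using (⊥-elim)
open import Data.Integer using (ℤ; +_; -_; _*_) renaming (_+_ to _+ℤ_)
import Data.Integer.Properties as ℤₚ
open import Data.Integer.Tactic.RingSolver using (solve-∀)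
open import Data.Nat as ℕ using (ℕ; zero; suc; _+_; _∸_; _^_; _≤_; _<_; z≤n; s≤s; _≟_)
import Data.Nat.Properties as ℕₚ
open import Data.Nat.Combinatorics using (_C_; nCk+nC[k+1]≡[n+1]C[k+1])
open import Data.Nat.Coprimality using (Coprime; coprime-divisor) renaming (sym to Coprime-sym)
open import Data.Nat.Divisibility
open import Data.Nat.DivMod using (_/_; _%_; m≡m%n+[m/n]*n; m%n<n)
open import Data.Nat.GCD using (gcd; gcd[m,n]∣m; gcd[m,n]∣n; gcd-greatest)
open import Data.Nat.ListAction using (product)
open import Data.Nat.Primality
  using (Prime; prime?; euclidsLemma; prime⇒irreducible; prime⇒nonZero; prime⇒nonTrivial; ¬prime[1])
open import Data.Nat.Primality.Factorisation using (factorise)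
open import Data.List using (List; []; _∷_; map; filter; length; _++_; applyUpTo)
import Data.List.Properties as LP
open import Data.List.Membership.DecPropositional _≟_ using (_∈?_)
open import Data.List.Membership.Propositional using (_∈_)
open import Data.List.Membership.Propositional.Properties using (∈-filter⁺; ∈-filter⁻; ∈-map⁻; ∈-++⁻)
open import Data.List.Relation.Unary.All as All using (All; []; _∷_; all?)
open import Data.List.Relation.Unary.Any using (here; there)
open import Data.Product using (_×_; _,_; proj₁; proj₂; Σ-syntax)
open import Data.Sum using (inj₁; inj₂; reduce)
open import Function using (id; _∘_)
open import Level using (0ℓ)
open import Relation.Binary.PropositionalEquality
open import Relation.Nullary using (Dec; yes; no; ¬_; ¬?)
open import Relation.Nullary.Decidable using (_×-dec_)
open import Relation.Unary using (Pred; Decidable)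

private variable
  A B : Set

-- Indicators and finite sums

𝟙 : Dec A → ℤ
𝟙 (yes _) = + 1
𝟙 (no _)  = + 0

𝟙-yes : (a? : Dec A) → A → 𝟙 a? ≡ + 1
𝟙-yes (yes _) _ = refl
𝟙-yes (no ¬a) a = ⊥-elim (¬a a)

𝟙-no : (a? : Dec A) → ¬ A → 𝟙 a? ≡ + 0
𝟙-no (yes a) ¬a = ⊥-elim (¬a a)
𝟙-no (no _)  _  = refl

𝟙-cong : (a? : Dec A) (b? : Dec B) → (A → B) → (B → A) → 𝟙 a? ≡ 𝟙 b?
𝟙-cong (yes a)  b? f g = sym (𝟙-yes b? (f a))
𝟙-cong (no ¬a) b? f g = sym (𝟙-no b? (λ b → ¬a (g b)))

𝟙-× : (a? : Dec A) (b? : Dec B) → 𝟙 (a? ×-dec b?) ≡ 𝟙 a? * 𝟙 b?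
𝟙-× (yes _) (yes _) = refl
𝟙-× (yes _) (no _)  = refl
𝟙-× (no _)  _       = refl

𝟙[suc≟suc] : ∀ j k → 𝟙 (suc j ≟ suc k) ≡ 𝟙 (j ≟ k)
𝟙[suc≟suc] j k = 𝟙-cong (suc j ≟ suc k) (j ≟ k) ℕₚ.suc-injective (cong suc)

∑ : List A → (A → ℤ) → ℤ
∑ xs f = sumℤ (map f xs)

syntax ∑ xs (λ x → e) = ∑[ x ← xs ] e

∑-++ : (xs ys : List A) (f : A → ℤ) → ∑ (xs ++ ys) f ≡ ∑ xs f +ℤ ∑ ys f
∑-++ []       ys f = sym (ℤₚ.+-identityˡ _)
∑-++ (x ∷ xs) ys f = trans (cong (f x +ℤ_) (∑-++ xs ys f)) (sym (ℤₚ.+-assoc (f x) _ _))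

∑-cong : (xs : List A) {f g : A → ℤ} → (∀ {x} → x ∈ xs → f x ≡ g x) → ∑ xs f ≡ ∑ xs g
∑-cong []       f≗g = refl
∑-cong (x ∷ xs) f≗g = cong₂ _+ℤ_ (f≗g (here refl)) (∑-cong xs (λ x∈xs → f≗g (there x∈xs)))

∑-zero : (xs : List A) {f : A → ℤ} → (∀ {x} → x ∈ xs → f x ≡ + 0) → ∑ xs f ≡ + 0
∑-zero []       f≗0 = refl
∑-zero (x ∷ xs) f≗0 = cong₂ _+ℤ_ (f≗0 (here refl)) (∑-zero xs (λ x∈xs → f≗0 (there x∈xs)))

∑-+ : (xs : List A) (f g : A → ℤ) → ∑[ x ← xs ] (f x +ℤ g x) ≡ ∑ xs f +ℤ ∑ xs g
∑-+ []       f g = refl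
∑-+ (x ∷ xs) f g = trans (cong (f x +ℤ g x +ℤ_) (∑-+ xs f g)) (interchange ℤₚ.+-commutativeSemigroup (f x) (g x) _ _)

∑-*ˡ : (xs : List A) (c : ℤ) (f : A → ℤ) → ∑[ x ← xs ] (c * f x) ≡ c * ∑ xs f
∑-*ˡ []       c f = sym (ℤₚ.*-zeroʳ c)
∑-*ˡ (x ∷ xs) c f = trans (cong (c * f x +ℤ_) (∑-*ˡ xs c f)) (sym (ℤₚ.*-distribˡ-+ c (f x) _))

∑-*ʳ : (xs : List A) (c : ℤ) (f : A → ℤ) → ∑[ x ← xs ] (f x * c) ≡ ∑ xs f * c
∑-*ʳ xs c f = trans (∑-cong xs (λ {x} _ → ℤₚ.*-comm (f x) c)) (trans (∑-*ˡ xs c f) (ℤₚ.*-comm c _))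

∑-neg : (xs : List A) (f : A → ℤ) → ∑[ x ← xs ] (- f x) ≡ - ∑ xs f
∑-neg []       f = refl
∑-neg (x ∷ xs) f = trans (cong (- f x +ℤ_) (∑-neg xs f)) (sym (ℤₚ.neg-distrib-+ (f x) _))

∑-map : (xs : List B) (g : B → A) (f : A → ℤ) → ∑ (map g xs) f ≡ ∑[ x ← xs ] f (g x)
∑-map []       g f = refl
∑-map (x ∷ xs) g f = cong (f (g x) +ℤ_) (∑-map xs g f)

∑-swap : (xs : List A) (ys : List B) (f : A → B → ℤ) →
         ∑[ x ← xs ] ∑[ y ← ys ] f x y ≡ ∑[ y ← ys ] ∑[ x ← xs ] f x y
∑-swap []       ys f = sym (∑-zero ys (λ _ → refl))
∑-swap (x ∷ xs) ys f = trans (cong (∑ ys (f x) +ℤ_) (∑-swap xs ys f)) (sym (∑-+ ys (f x) _))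

module _ {P : Pred A 0ℓ} (P? : Decidable P) where

  ∑-filter : (xs : List A) (f : A → ℤ) → ∑ (filter P? xs) f ≡ ∑[ x ← xs ] (𝟙 (P? x) * f x)
  ∑-filter []       f = refl
  ∑-filter (x ∷ xs) f with P? x
  ... | yes _ = cong₂ _+ℤ_ (sym (ℤₚ.*-identityˡ (f x))) (∑-filter xs f)
  ... | no _  = trans (∑-filter xs f) (sym (ℤₚ.+-identityˡ _))

  ∑-partition : (xs : List A) (f : A → ℤ) →
                ∑ xs f ≡ ∑[ x ← xs ] (𝟙 (P? x) * f x) +ℤ ∑[ x ← xs ] (𝟙 (¬? (P? x)) * f x)
  ∑-partition xs f = trans (∑-cong xs (λ {x} _ → split x)) (∑-+ xs _ _)
    where
    split : ∀ x → f x ≡ 𝟙 (P? x) * f x +ℤ 𝟙 (¬? (P? x)) * f x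
    split x with P? x
    ... | yes _ = sym (trans (ℤₚ.+-identityʳ _) (ℤₚ.*-identityˡ (f x)))
    ... | no _  = sym (trans (ℤₚ.+-identityˡ _) (ℤₚ.*-identityˡ (f x)))

  length-filter≡∑𝟙 : (xs : List A) → + length (filter P? xs) ≡ ∑[ x ← xs ] 𝟙 (P? x)
  length-filter≡∑𝟙 []       = refl
  length-filter≡∑𝟙 (x ∷ xs) with P? x
  ... | yes _ = trans (ℤₚ.pos-+ 1 _) (cong (+ 1 +ℤ_) (length-filter≡∑𝟙 xs))
  ... | no _  = trans (length-filter≡∑𝟙 xs) (sym (ℤₚ.+-identityˡ _))

-- Segments of ℕ and the multiples they contain

segment : ℕ → ℕ → List ℕ
segment a zero    = []
segment a (suc k) = a ∷ segment (suc a) k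

segment-++ : ∀ a k j → segment a (k + j) ≡ segment a k ++ segment (a + k) j
segment-++ a zero    j = cong (λ b → segment b j) (sym (ℕₚ.+-identityʳ a))
segment-++ a (suc k) j = cong (a ∷_) (trans (segment-++ (suc a) k j)
  (cong (λ b → segment (suc a) k ++ segment b j) (sym (ℕₚ.+-suc a k))))

∈-segment⁻ : ∀ {x} a k → x ∈ segment a k → a ≤ x × x < a + k
∈-segment⁻ a (suc k) (here refl) = ℕₚ.≤-refl , ℕₚ.m<m+n a (s≤s z≤n)
∈-segment⁻ a (suc k) (there x∈) with a<x , x<a+k ← ∈-segment⁻ (suc a) k x∈ =
  ℕₚ.<⇒≤ a<x , ℕₚ.<-≤-trans x<a+k (ℕₚ.≤-reflexive (sym (ℕₚ.+-suc a k)))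

∈-segment⁺ : ∀ {x} a k → a ≤ x → x < a + k → x ∈ segment a k
∈-segment⁺ a zero    a≤x x<a+0 = ⊥-elim (ℕₚ.<⇒≱ (ℕₚ.<-≤-trans x<a+0 (ℕₚ.≤-reflexive (ℕₚ.+-identityʳ a))) a≤x)
∈-segment⁺ {x} a (suc k) a≤x x<a+k with a ≟ x
... | yes refl = here refl
... | no a≢x   = there (∈-segment⁺ (suc a) k (ℕₚ.≤∧≢⇒< a≤x a≢x) (ℕₚ.<-≤-trans x<a+k (ℕₚ.≤-reflexive (ℕₚ.+-suc a k))))

applyUpTo≡segment : ∀ (f : ℕ → ℕ) a k → (∀ i → f i ≡ a + i) → applyUpTo f k ≡ segment a k
applyUpTo≡segment f a zero    f≗a+ = refl
applyUpTo≡segment f a (suc k) f≗a+ = cong₂ _∷_ (trans (f≗a+ 0) (ℕₚ.+-identityʳ a))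
  (applyUpTo≡segment (f ∘ suc) (suc a) k (λ i → trans (f≗a+ (suc i)) (ℕₚ.+-suc a i)))

interval≡segment : ∀ a b → interval a b ≡ segment a (suc b ∸ a)
interval≡segment a b = trans (LP.map-applyUpTo id (λ i → a + i) (suc b ∸ a))
                             (applyUpTo≡segment (λ i → a + i) a (suc b ∸ a) (λ _ → refl))

∑-segment-shift : ∀ b a k (f : ℕ → ℤ) → ∑ (segment (b + a) k) f ≡ ∑[ x ← segment a k ] f (b + x)
∑-segment-shift b a zero    f = refl
∑-segment-shift b a (suc k) f = cong (f (b + a) +ℤ_)
  (trans (cong (λ c → ∑ (segment c k) f) (sym (ℕₚ.+-suc b a))) (∑-segment-shift b (suc a) k f))

∑-segment-vanishing-tail : ∀ c k (f : ℕ → ℤ) → c ≤ k → (∀ x → c < x → f x ≡ + 0) →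
                           ∑ (segment 1 k) f ≡ ∑ (segment 1 c) f
∑-segment-vanishing-tail c k f c≤k tail≡0 = begin
  ∑ (segment 1 k) f                                         ≡⟨ cong (λ j → ∑ (segment 1 j) f) (sym (ℕₚ.m+[n∸m]≡n c≤k)) ⟩
  ∑ (segment 1 (c + (k ∸ c))) f                             ≡⟨ cong (λ xs → ∑ xs f) (segment-++ 1 c (k ∸ c)) ⟩
  ∑ (segment 1 c ++ segment (suc c) (k ∸ c)) f              ≡⟨ ∑-++ (segment 1 c) _ f ⟩
  ∑ (segment 1 c) f +ℤ ∑ (segment (suc c) (k ∸ c)) f        ≡⟨ cong (∑ (segment 1 c) f +ℤ_) tail ⟩
  ∑ (segment 1 c) f +ℤ + 0                                  ≡⟨ ℤₚ.+-identityʳ _ ⟩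
  ∑ (segment 1 c) f                                         ∎
  where
  open ≡-Reasoning
  tail : ∑ (segment (suc c) (k ∸ c)) f ≡ + 0
  tail = ∑-zero (segment (suc c) (k ∸ c)) (λ x∈ → tail≡0 _ (proj₁ (∈-segment⁻ (suc c) (k ∸ c) x∈)))

∑-segment-𝟙≟ : ∀ p a k → a ≤ p → p < a + k → ∑[ x ← segment a k ] 𝟙 (x ≟ p) ≡ + 1
∑-segment-𝟙≟ p a zero    a≤p p<a+0 = ⊥-elim (ℕₚ.<⇒≱ (ℕₚ.<-≤-trans p<a+0 (ℕₚ.≤-reflexive (ℕₚ.+-identityʳ a))) a≤p)
∑-segment-𝟙≟ p a (suc k) a≤p p<a+k with a ≟ p
... | yes refl = trans (cong (+ 1 +ℤ_) (∑-zero (segment (suc a) k) (λ x∈ → 𝟙-no (_ ≟ a)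
                   (λ { refl → ℕₚ.<-irrefl refl (proj₁ (∈-segment⁻ (suc a) k x∈)) }))))
                   (ℤₚ.+-identityʳ (+ 1))
... | no a≢p   = trans (ℤₚ.+-identityˡ _)
                   (∑-segment-𝟙≟ p (suc a) k (ℕₚ.≤∧≢⇒< a≤p a≢p) (ℕₚ.<-≤-trans p<a+k (ℕₚ.≤-reflexive (ℕₚ.+-suc a k))))

∤-between : ∀ {p i} q → 0 < i → i < p → ¬ p ∣ q ℕ.* p + i
∤-between q 0<i i<p p∣ = ℕₚ.<⇒≱ i<p (∣⇒≤ {{ℕ.>-nonZero 0<i}} (∣m+n∣m⇒∣n p∣ (n∣m*n q)))

∑-segment-no-multiple : ∀ p q r (g : ℕ → ℤ) → r < p →
                        ∑[ x ← segment (suc (q ℕ.* p)) r ] (𝟙 (p ∣? x) * g x) ≡ + 0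
∑-segment-no-multiple p q r g r<p = begin
  ∑ (segment (suc (q ℕ.* p)) r) F               ≡⟨ cong (λ a → ∑ (segment a r) F) (ℕₚ.+-comm 1 (q ℕ.* p)) ⟩
  ∑ (segment (q ℕ.* p + 1) r) F                 ≡⟨ ∑-segment-shift (q ℕ.* p) 1 r F ⟩
  ∑[ i ← segment 1 r ] F (q ℕ.* p + i)          ≡⟨ ∑-zero (segment 1 r) no-multiple ⟩
  + 0                                           ∎
  where
  open ≡-Reasoning
  F : ℕ → ℤ
  F x = 𝟙 (p ∣? x) * g x
  no-multiple : ∀ {i} → i ∈ segment 1 r → F (q ℕ.* p + i) ≡ + 0
  no-multiple {i} i∈ with 1≤i , i<1+r ← ∈-segment⁻ 1 r i∈ =
    cong (_* g (q ℕ.* p + i)) (𝟙-no (p ∣? (q ℕ.* p + i)) (∤-between q 1≤i (ℕₚ.<-≤-trans i<1+r r<p)))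

∑-multiples : ∀ p m (g : ℕ → ℤ) → 1 ≤ p →
              ∑[ x ← segment 1 (m ℕ.* p) ] (𝟙 (p ∣? x) * g x) ≡ ∑[ e ← segment 1 m ] g (e ℕ.* p)
∑-multiples p zero    g _ = refl
∑-multiples p@(suc p′) (suc m) g 1≤p = begin
  ∑ (segment 1 (p + m ℕ.* p)) F                                ≡⟨ cong (λ xs → ∑ xs F) (segment-++ 1 p (m ℕ.* p)) ⟩
  ∑ (segment 1 p ++ segment (suc p) (m ℕ.* p)) F               ≡⟨ ∑-++ (segment 1 p) _ F ⟩
  ∑ (segment 1 p) F +ℤ ∑ (segment (suc p) (m ℕ.* p)) F         ≡⟨ cong₂ _+ℤ_ first-block later-blocks ⟩
  g p +ℤ ∑[ e ← segment 1 m ] g (suc e ℕ.* p)                  ≡⟨ cong₂ _+ℤ_ (cong g (sym (ℕₚ.*-identityˡ p)))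
                                                                          (sym (∑-segment-shift 1 1 m (λ e → g (e ℕ.* p)))) ⟩
  ∑[ e ← segment 1 (suc m) ] g (e ℕ.* p)                       ∎
  where
  open ≡-Reasoning
  F : ℕ → ℤ
  F x = 𝟙 (p ∣? x) * g x
  first-block : ∑ (segment 1 p) F ≡ g p
  first-block = begin
    ∑ (segment 1 p) F                       ≡⟨ cong (λ j → ∑ (segment 1 j) F) (ℕₚ.+-comm 1 p′) ⟩
    ∑ (segment 1 (p′ + 1)) F                ≡⟨ cong (λ xs → ∑ xs F) (segment-++ 1 p′ 1) ⟩
    ∑ (segment 1 p′ ++ p ∷ []) F            ≡⟨ ∑-++ (segment 1 p′) _ F ⟩
    ∑ (segment 1 p′) F +ℤ (F p +ℤ + 0)      ≡⟨ cong₂ _+ℤ_ (∑-segment-no-multiple p 0 p′ g ℕₚ.≤-refl) (ℤₚ.+-identityʳ (F p)) ⟩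
    + 0 +ℤ F p                              ≡⟨ ℤₚ.+-identityˡ (F p) ⟩
    𝟙 (p ∣? p) * g p                        ≡⟨ cong (_* g p) (𝟙-yes (p ∣? p) ∣-refl) ⟩
    + 1 * g p                               ≡⟨ ℤₚ.*-identityˡ (g p) ⟩
    g p                                     ∎
  later-blocks : ∑ (segment (suc p) (m ℕ.* p)) F ≡ ∑[ e ← segment 1 m ] g (suc e ℕ.* p)
  later-blocks = begin
    ∑ (segment (suc p) (m ℕ.* p)) F                              ≡⟨ cong (λ a → ∑ (segment a (m ℕ.* p)) F) (ℕₚ.+-comm 1 p) ⟩
    ∑ (segment (p + 1) (m ℕ.* p)) F                              ≡⟨ ∑-segment-shift p 1 (m ℕ.* p) F ⟩
    ∑[ x ← segment 1 (m ℕ.* p) ] F (p + x)                       ≡⟨ ∑-cong (segment 1 (m ℕ.* p)) (λ {x} _ → cong (_* g (p + x))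
                                                                      (𝟙-cong (p ∣? p + x) (p ∣? x) (λ p∣ → ∣m+n∣m⇒∣n p∣ ∣-refl) (∣m∣n⇒∣m+n ∣-refl))) ⟩
    ∑[ x ← segment 1 (m ℕ.* p) ] (𝟙 (p ∣? x) * g (p + x))        ≡⟨ ∑-multiples p m (λ x → g (p + x)) 1≤p ⟩
    ∑[ e ← segment 1 m ] g (suc e ℕ.* p)                         ∎

∑-segment-1 : ∀ a k → ∑[ _ ← segment a k ] (+ 1) ≡ + k
∑-segment-1 a zero    = refl
∑-segment-1 a (suc k) = trans (cong (+ 1 +ℤ_) (∑-segment-1 (suc a) k)) (sym (ℤₚ.pos-+ 1 k))

length-filter-∣-segment : ∀ d N .{{_ : ℕ.NonZero d}} → length (filter (d ∣?_) (segment 1 N)) ≡ N / d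
length-filter-∣-segment d N = ℤₚ.+-injective (begin
  + length (filter (d ∣?_) (segment 1 N))          ≡⟨ length-filter≡∑𝟙 (d ∣?_) (segment 1 N) ⟩
  ∑[ x ← segment 1 N ] 𝟙 (d ∣? x)                  ≡⟨ ∑-cong (segment 1 N) (λ {x} _ → sym (ℤₚ.*-identityʳ (𝟙 (d ∣? x)))) ⟩
  ∑ (segment 1 N) F                                ≡⟨ cong (λ j → ∑ (segment 1 j) F) (trans (m≡m%n+[m/n]*n N d) (ℕₚ.+-comm (N % d) _)) ⟩
  ∑ (segment 1 (q ℕ.* d + N % d)) F                ≡⟨ cong (λ xs → ∑ xs F) (segment-++ 1 (q ℕ.* d) (N % d)) ⟩
  ∑ (segment 1 (q ℕ.* d) ++ segment (suc (q ℕ.* d)) (N % d)) F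
                                                   ≡⟨ ∑-++ (segment 1 (q ℕ.* d)) _ F ⟩
  ∑ (segment 1 (q ℕ.* d)) F +ℤ ∑ (segment (suc (q ℕ.* d)) (N % d)) F
                                                   ≡⟨ cong₂ _+ℤ_ (∑-multiples d q (λ _ → + 1) (ℕ.>-nonZero⁻¹ d))
                                                                 (∑-segment-no-multiple d q (N % d) (λ _ → + 1) (m%n<n N d)) ⟩
  ∑[ _ ← segment 1 q ] (+ 1) +ℤ + 0                ≡⟨ ℤₚ.+-identityʳ _ ⟩
  ∑[ _ ← segment 1 q ] (+ 1)                       ≡⟨ ∑-segment-1 1 q ⟩
  + q                                              ∎)
  where
  open ≡-Reasoning
  q : ℕ
  q = N / d
  F : ℕ → ℤ
  F x = 𝟙 (d ∣? x) * + 1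

-- The Möbius function

prime⇒1≤ : ∀ {p} → Prime p → 1 ≤ p
prime⇒1≤ {p} pp = ℕₚ.<⇒≤ (ℕ.nonTrivial⇒n>1 p {{prime⇒nonTrivial pp}})

prime∣prime⇒≡ : ∀ {p q} → Prime p → Prime q → p ∣ q → p ≡ q
prime∣prime⇒≡ pp pq p∣q with prime⇒irreducible pq p∣q
... | inj₁ refl = ⊥-elim (¬prime[1] pp)
... | inj₂ p≡q  = p≡q

prime∤⇒coprime : ∀ {p x} → Prime p → ¬ p ∣ x → Coprime p x
prime∤⇒coprime pp p∤x (i∣p , i∣x) with prime⇒irreducible pp i∣p
... | inj₁ i≡1 = i≡1
... | inj₂ refl = ⊥-elim (p∤x i∣x)

∃-prime-divisor : ∀ c → 2 ≤ c → Σ[ p ∈ ℕ ] (Prime p × p ∣ c)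
∃-prime-divisor c@(suc _) 2≤c with factorise c
... | record { factors = [] ; isFactorisation = c≡1 } = ⊥-elim (ℕₚ.<-irrefl (sym c≡1) 2≤c)
... | record { factors = p ∷ ps ; isFactorisation = c≡Πps ; factorsPrime = pp ∷ _ } =
  p , pp , subst (p ∣_) (sym c≡Πps) (m∣m*n (product ps))

∈-primeDivisors⁻ : ∀ {q d} → q ∈ primeDivisors d → Prime q × q ∣ d
∈-primeDivisors⁻ {d = d} q∈ = proj₂ (∈-filter⁻ (λ p → prime? p ×-dec p ∣? d) {xs = interval 1 d} q∈)

∈-primeDivisors⁺ : ∀ {q d} → 1 ≤ d → Prime q → q ∣ d → q ∈ primeDivisors d
∈-primeDivisors⁺ {q} {d@(suc _)} _ pq q∣d = ∈-filter⁺ (λ p → prime? p ×-dec p ∣? d)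
  (subst (q ∈_) (sym (interval≡segment 1 d)) (∈-segment⁺ 1 d (prime⇒1≤ pq) (s≤s (∣⇒≤ q∣d))))
  (pq , q∣d)

squareFree⁻ : ∀ {q d} → 1 ≤ d → SquareFree d → Prime q → q ∣ d → ¬ q ℕ.* q ∣ d
squareFree⁻ 1≤d sf pq q∣d = All.lookup sf (∈-primeDivisors⁺ 1≤d pq q∣d)

squareFree⁺ : ∀ d → (∀ {q} → Prime q → q ∣ d → ¬ q ℕ.* q ∣ d) → SquareFree d
squareFree⁺ d sf = All.tabulate (λ q∈ → let pq , q∣d = ∈-primeDivisors⁻ q∈ in sf pq q∣d)

μ-squareFree : ∀ d → SquareFree d → μ d ≡ neg1^ (length (primeDivisors d))
μ-squareFree d sf with squareFree? d
... | yes _   = refl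
... | no ¬sf  = ⊥-elim (¬sf sf)

μ-¬squareFree : ∀ d → ¬ SquareFree d → μ d ≡ + 0
μ-¬squareFree d ¬sf with squareFree? d
... | yes sf = ⊥-elim (¬sf sf)
... | no _   = refl

μ[p*e]≡0 : ∀ {p e} → Prime p → p ∣ e → 1 ≤ e → μ (p ℕ.* e) ≡ + 0
μ[p*e]≡0 {p} {e} pp p∣e 1≤e = μ-¬squareFree (p ℕ.* e)
  (λ sf → squareFree⁻ (ℕₚ.*-mono-≤ (prime⇒1≤ pp) 1≤e) sf pp (m∣m*n e) (*-monoʳ-∣ p p∣e))

length-primeDivisors : ∀ d → + length (primeDivisors d) ≡ ∑[ x ← segment 1 d ] 𝟙 (prime? x ×-dec x ∣? d)
length-primeDivisors d = trans (length-filter≡∑𝟙 (λ x → prime? x ×-dec x ∣? d) (interval 1 d))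
                               (cong (λ xs → ∑ xs (λ x → 𝟙 (prime? x ×-dec x ∣? d))) (interval≡segment 1 d))

module _ {p e} (pp : Prime p) (p∤e : ¬ p ∣ e) (1≤e : 1 ≤ e) where

  private
    prime∣p*e⇒∣e : ∀ {q} → Prime q → q ≢ p → q ∣ p ℕ.* e → q ∣ e
    prime∣p*e⇒∣e pq q≢p q∣pe with euclidsLemma p e pq q∣pe
    ... | inj₁ q∣p = ⊥-elim (q≢p (prime∣prime⇒≡ pq pp q∣p))
    ... | inj₂ q∣e = q∣e

  squareFree-*⁺ : SquareFree e → SquareFree (p ℕ.* e)
  squareFree-*⁺ sf = squareFree⁺ (p ℕ.* e) ¬q²∣pe
    where
    ¬q²∣pe : ∀ {q} → Prime q → q ∣ p ℕ.* e → ¬ q ℕ.* q ∣ p ℕ.* e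
    ¬q²∣pe {q} pq q∣pe q²∣pe with q ≟ p
    ... | yes refl = p∤e (*-cancelˡ-∣ q {{prime⇒nonZero pq}} q²∣pe)
    ... | no q≢p   = squareFree⁻ 1≤e sf pq (prime∣p*e⇒∣e pq q≢p q∣pe) (coprime-divisor q²⊥p q²∣pe)
      where
      q²⊥p : Coprime (q ℕ.* q) p
      q²⊥p = Coprime-sym (prime∤⇒coprime pp
        (λ p∣q² → q≢p (sym (prime∣prime⇒≡ pp pq (reduce (euclidsLemma q q pp p∣q²))))))

  squareFree-*⁻ : SquareFree (p ℕ.* e) → SquareFree e
  squareFree-*⁻ sf = squareFree⁺ e (λ pq q∣e q²∣e →
    squareFree⁻ (ℕₚ.*-mono-≤ (prime⇒1≤ pp) 1≤e) sf pq (∣n⇒∣m*n p q∣e) (∣n⇒∣m*n p q²∣e))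

  length-primeDivisors-* : length (primeDivisors (p ℕ.* e)) ≡ suc (length (primeDivisors e))
  length-primeDivisors-* = ℤₚ.+-injective (begin
    + length (primeDivisors (p ℕ.* e))                                  ≡⟨ length-primeDivisors (p ℕ.* e) ⟩
    ∑[ x ← segment 1 (p ℕ.* e) ] 𝟙 (Q[pe] x)                            ≡⟨ ∑-cong (segment 1 (p ℕ.* e)) (λ {x} _ → split x) ⟩
    ∑[ x ← segment 1 (p ℕ.* e) ] (𝟙 (x ≟ p) +ℤ 𝟙 (Q[e] x))              ≡⟨ ∑-+ (segment 1 (p ℕ.* e)) _ _ ⟩
    ∑[ x ← segment 1 (p ℕ.* e) ] 𝟙 (x ≟ p) +ℤ ∑[ x ← segment 1 (p ℕ.* e) ] 𝟙 (Q[e] x)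
                                                                        ≡⟨ cong₂ _+ℤ_ (∑-segment-𝟙≟ p 1 (p ℕ.* e) (prime⇒1≤ pp) (s≤s p≤pe))
                                                                                      (∑-segment-vanishing-tail e (p ℕ.* e) _ e≤pe beyond-e) ⟩
    + 1 +ℤ ∑[ x ← segment 1 e ] 𝟙 (Q[e] x)                              ≡⟨ cong (+ 1 +ℤ_) (sym (length-primeDivisors e)) ⟩
    + 1 +ℤ + length (primeDivisors e)                                   ∎)
    where
    open ≡-Reasoning
    instance _ = ℕ.>-nonZero 1≤e
    Q[pe] : (x : ℕ) → Dec (Prime x × x ∣ p ℕ.* e)
    Q[pe] x = prime? x ×-dec x ∣? p ℕ.* e
    Q[e] : (x : ℕ) → Dec (Prime x × x ∣ e)
    Q[e] x = prime? x ×-dec x ∣? e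
    p≤pe : p ≤ p ℕ.* e
    p≤pe = ℕₚ.m≤m*n p e
    e≤pe : e ≤ p ℕ.* e
    e≤pe = ℕₚ.m≤n*m e p {{prime⇒nonZero pp}}
    beyond-e : ∀ x → e < x → 𝟙 (Q[e] x) ≡ + 0
    beyond-e x e<x = 𝟙-no (Q[e] x) (λ (_ , x∣e) → >⇒∤ e<x x∣e)
    split : ∀ x → 𝟙 (Q[pe] x) ≡ 𝟙 (x ≟ p) +ℤ 𝟙 (Q[e] x)
    split x with x ≟ p
    ... | yes refl = trans (𝟙-yes (Q[pe] x) (pp , m∣m*n e)) (cong (+ 1 +ℤ_) (sym (𝟙-no (Q[e] x) (λ (_ , p∣e) → p∤e p∣e))))
    ... | no x≢p   = trans (𝟙-cong (Q[pe] x) (Q[e] x) (λ (px , x∣pe) → px , prime∣p*e⇒∣e px x≢p x∣pe)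
                                                       (λ (px , x∣e) → px , ∣n⇒∣m*n p x∣e))
                           (sym (ℤₚ.+-identityˡ _))

  μ[p*e]≡-μ[e] : μ (p ℕ.* e) ≡ - μ e
  μ[p*e]≡-μ[e] with squareFree? e
  ... | yes sf  = trans (μ-squareFree (p ℕ.* e) (squareFree-*⁺ sf)) (cong neg1^ length-primeDivisors-*)
  ... | no ¬sf  = μ-¬squareFree (p ℕ.* e) (¬sf ∘ squareFree-*⁻)

divisorSum≡∑-segment : ∀ c (f : ℕ → ℤ) → divisorSum c f ≡ ∑[ x ← segment 1 c ] (𝟙 (x ∣? c) * f x)
divisorSum≡∑-segment c f = trans (∑-filter (_∣? c) (interval 1 c) f)
                                 (cong (λ xs → ∑[ x ← xs ] (𝟙 (x ∣? c) * f x)) (interval≡segment 1 c))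

∈-divisors⁻ : ∀ {d} k → d ∈ divisors k → d ∣ k × 1 ≤ d
∈-divisors⁻ {d} k d∈ with d∈[1,k] , d∣k ← ∈-filter⁻ (_∣? k) {xs = interval 1 k} d∈ =
  d∣k , proj₁ (∈-segment⁻ 1 k (subst (d ∈_) (interval≡segment 1 k) d∈[1,k]))

-- A divisor of m p prime to p divides m, while the ones divisible by p are the e p with e ∣ m,
-- and μ (e p) is − μ e or 0 according as p ∤ e or p ∣ e: the two parts cancel.
divisorSum-μ-* : ∀ {p} m → Prime p → 1 ≤ m → divisorSum (m ℕ.* p) μ ≡ + 0
divisorSum-μ-* {p} m pp 1≤m = begin
  divisorSum (m ℕ.* p) μ                                                  ≡⟨ divisorSum≡∑-segment (m ℕ.* p) μ ⟩
  ∑ L F                                                                   ≡⟨ ∑-partition (p ∣?_) L F ⟩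
  ∑[ x ← L ] (𝟙 (p ∣? x) * F x) +ℤ ∑[ x ← L ] (𝟙 (¬? (p ∣? x)) * F x)     ≡⟨ cong₂ _+ℤ_ multiples-of-p coprime-to-p ⟩
  - ∑ (segment 1 m) G +ℤ ∑ (segment 1 m) G                                ≡⟨ ℤₚ.+-inverseˡ (∑ (segment 1 m) G) ⟩
  + 0                                                                     ∎
  where
  open ≡-Reasoning
  instance _ = prime⇒nonZero pp
  instance _ = ℕ.>-nonZero 1≤m
  L : List ℕ
  L = segment 1 (m ℕ.* p)
  F G : ℕ → ℤ
  F x = 𝟙 (x ∣? m ℕ.* p) * μ x
  G x = 𝟙 (¬? (p ∣? x)) * (𝟙 (x ∣? m) * μ x)

  F[e*p]≡-G[e] : ∀ e → 1 ≤ e → F (e ℕ.* p) ≡ - G e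
  F[e*p]≡-G[e] e 1≤e with p ∣? e
  ... | yes p∣e = trans (cong (𝟙 (e ℕ.* p ∣? m ℕ.* p) *_) (trans (cong μ (ℕₚ.*-comm e p)) (μ[p*e]≡0 pp p∣e 1≤e)))
                        (ℤₚ.*-zeroʳ (𝟙 (e ℕ.* p ∣? m ℕ.* p)))
  ... | no p∤e  = begin
    𝟙 (e ℕ.* p ∣? m ℕ.* p) * μ (e ℕ.* p)    ≡⟨ cong₂ _*_ (𝟙-cong (e ℕ.* p ∣? m ℕ.* p) (e ∣? m) (*-cancelʳ-∣ p) (*-monoˡ-∣ p))
                                                           (trans (cong μ (ℕₚ.*-comm e p)) (μ[p*e]≡-μ[e] pp p∤e 1≤e)) ⟩
    𝟙 (e ∣? m) * - μ e                      ≡⟨ ℤₚ.neg-distribʳ-* (𝟙 (e ∣? m)) (μ e) ⟨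
    - (𝟙 (e ∣? m) * μ e)                    ≡⟨ cong -_ (ℤₚ.*-identityˡ _) ⟨
    - (+ 1 * (𝟙 (e ∣? m) * μ e))            ∎

  multiples-of-p : ∑[ x ← L ] (𝟙 (p ∣? x) * F x) ≡ - ∑ (segment 1 m) G
  multiples-of-p = begin
    ∑[ x ← L ] (𝟙 (p ∣? x) * F x)             ≡⟨ ∑-multiples p m F (prime⇒1≤ pp) ⟩
    ∑[ e ← segment 1 m ] F (e ℕ.* p)          ≡⟨ ∑-cong (segment 1 m) (λ e∈ → F[e*p]≡-G[e] _ (proj₁ (∈-segment⁻ 1 m e∈))) ⟩
    ∑[ e ← segment 1 m ] (- G e)              ≡⟨ ∑-neg (segment 1 m) G ⟩
    - ∑ (segment 1 m) G                       ∎

  coprime-to-p : ∑[ x ← L ] (𝟙 (¬? (p ∣? x)) * F x) ≡ ∑ (segment 1 m) G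
  coprime-to-p = trans (∑-cong L (λ {x} _ → drop-p x))
    (∑-segment-vanishing-tail m (m ℕ.* p) G (ℕₚ.m≤m*n m p)
      (λ x m<x → trans (cong (λ z → 𝟙 (¬? (p ∣? x)) * (z * μ x)) (𝟙-no (x ∣? m) (>⇒∤ m<x))) (ℤₚ.*-zeroʳ (𝟙 (¬? (p ∣? x))))))
    where
    drop-p : ∀ x → 𝟙 (¬? (p ∣? x)) * F x ≡ G x
    drop-p x with p ∣? x
    ... | yes _   = refl
    ... | no p∤x  = cong (λ z → + 1 * (z * μ x)) (𝟙-cong (x ∣? m ℕ.* p) (x ∣? m)
                      (λ x∣mp → coprime-divisor (Coprime-sym (prime∤⇒coprime pp p∤x)) (subst (x ∣_) (ℕₚ.*-comm m p) x∣mp))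
                      (∣m⇒∣m*n p))

divisorSum-μ : ∀ c → 1 ≤ c → divisorSum c μ ≡ 𝟙 (c ≟ 1)
divisorSum-μ (suc zero)    _ = refl
divisorSum-μ c@(suc (suc _)) _ with p , pp , divides m c≡m*p ← ∃-prime-divisor c (s≤s (s≤s z≤n)) =
  subst (λ n → divisorSum n μ ≡ + 0) (sym c≡m*p) (divisorSum-μ-* m pp (1≤m m c≡m*p))
  where
  1≤m : ∀ m → c ≡ m ℕ.* p → 1 ≤ m
  1≤m (suc _) _ = s≤s z≤n

divisorSum-∣-μ : ∀ {c k} → 1 ≤ c → 1 ≤ k → c ∣ k → divisorSum k (λ d → 𝟙 (d ∣? c) * μ d) ≡ 𝟙 (c ≟ 1)
divisorSum-∣-μ {c} {k} 1≤c 1≤k c∣k = begin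
  divisorSum k (λ d → 𝟙 (d ∣? c) * μ d)                  ≡⟨ divisorSum≡∑-segment k _ ⟩
  ∑[ x ← segment 1 k ] (𝟙 (x ∣? k) * (𝟙 (x ∣? c) * μ x)) ≡⟨ ∑-cong (segment 1 k) (λ {x} _ → drop-∣k x) ⟩
  ∑[ x ← segment 1 k ] (𝟙 (x ∣? c) * μ x)                ≡⟨ ∑-segment-vanishing-tail c k _ (∣⇒≤ {{ℕ.>-nonZero 1≤k}} c∣k)
                                                            (λ x c<x → cong (_* μ x) (𝟙-no (x ∣? c) (>⇒∤ {{ℕ.>-nonZero 1≤c}} c<x))) ⟩
  ∑[ x ← segment 1 c ] (𝟙 (x ∣? c) * μ x)                ≡⟨ divisorSum≡∑-segment c μ ⟨
  divisorSum c μ                                         ≡⟨ divisorSum-μ c 1≤c ⟩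
  𝟙 (c ≟ 1)                                              ∎
  where
  open ≡-Reasoning
  drop-∣k : ∀ x → 𝟙 (x ∣? k) * (𝟙 (x ∣? c) * μ x) ≡ 𝟙 (x ∣? c) * μ x
  drop-∣k x with x ∣? c
  ... | yes x∣c = trans (cong (_* (+ 1 * μ x)) (𝟙-yes (x ∣? k) (∣-trans x∣c c∣k))) (ℤₚ.*-identityˡ _)
  ... | no _    = ℤₚ.*-zeroʳ (𝟙 (x ∣? k))

-- Möbius inversion of the coprimality condition

gcdWith-∣ : ∀ X n → gcdWith X n ∣ n
gcdWith-∣ []      n = ∣-refl
gcdWith-∣ (a ∷ X) n = ∣-trans (gcd[m,n]∣n a _) (gcdWith-∣ X n)

gcdWith-∣-∈ : ∀ {x} X n → x ∈ X → gcdWith X n ∣ x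
gcdWith-∣-∈ (a ∷ X) n (here refl) = gcd[m,n]∣m a _
gcdWith-∣-∈ (a ∷ X) n (there x∈X) = ∣-trans (gcd[m,n]∣n a _) (gcdWith-∣-∈ X n x∈X)

gcdWith-greatest : ∀ {d} X n → d ∣ n → All (d ∣_) X → d ∣ gcdWith X n
gcdWith-greatest []      n d∣n []           = d∣n
gcdWith-greatest (a ∷ X) n d∣n (d∣a ∷ d∣X) = gcd-greatest d∣a (gcdWith-greatest X n d∣n d∣X)

∣gcdWith⇒All∣ : ∀ {d} X n → d ∣ gcdWith X n → All (d ∣_) X
∣gcdWith⇒All∣ []      n _   = []
∣gcdWith⇒All∣ (a ∷ X) n d∣g = ∣-trans d∣g (gcd[m,n]∣m a _) ∷ ∣gcdWith⇒All∣ X n (∣-trans d∣g (gcd[m,n]∣n a _))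

gcdWith≥1 : ∀ X n → 1 ≤ n → 1 ≤ gcdWith X n
gcdWith≥1 X n 1≤n with gcdWith X n | gcdWith-∣ X n
... | suc _ | _   = s≤s z≤n
... | zero  | 0∣n = ⊥-elim (ℕₚ.<-irrefl (sym (0∣⇒≡0 0∣n)) 1≤n)

𝟙[gcdWith≡1]≡divisorSum : ∀ {l} X n → 1 ≤ n → l ∈ X →
                          𝟙 (gcdWith X n ≟ 1) ≡ divisorSum (gcd l n) (λ d → 𝟙 (d ∣? gcdWith X n) * μ d)
𝟙[gcdWith≡1]≡divisorSum {l} X n 1≤n l∈X = sym (divisorSum-∣-μ (gcdWith≥1 X n 1≤n) (gcdWith≥1 (l ∷ []) n 1≤n)
  (gcd-greatest (gcdWith-∣-∈ X n l∈X) (gcdWith-∣ X n)))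

∑-good≡divisorSum : ∀ l n → 1 ≤ n → (S : List (List ℕ)) (w : List ℕ → ℤ) →
  ∑[ X ← S ] (𝟙 (good? l n X) * w X)
  ≡ divisorSum (gcd l n) (λ d → μ d * ∑[ X ← S ] (𝟙 (l ∈? X) * (𝟙 (all? (d ∣?_) X) * w X)))
∑-good≡divisorSum l n 1≤n S w = begin
  ∑[ X ← S ] (𝟙 (good? l n X) * w X)      ≡⟨ ∑-cong S (λ {X} _ → trans (cong (_* w X) (𝟙-× (l ∈? X) (gcdWith X n ≟ 1)))
                                                                       (expand X (l ∈? X))) ⟩
  ∑[ X ← S ] ∑[ d ← D ] (μ d * T d X)     ≡⟨ ∑-swap S D _ ⟩
  ∑[ d ← D ] ∑[ X ← S ] (μ d * T d X)     ≡⟨ ∑-cong D (λ {d} _ → ∑-*ˡ S (μ d) (T d)) ⟩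
  ∑[ d ← D ] (μ d * ∑ S (T d))            ∎
  where
  open ≡-Reasoning
  D : List ℕ
  D = divisors (gcd l n)
  T : ℕ → List ℕ → ℤ
  T d X = 𝟙 (l ∈? X) * (𝟙 (all? (d ∣?_) X) * w X)

  expand : ∀ X (l∈? : Dec (l ∈ X)) →
           𝟙 l∈? * 𝟙 (gcdWith X n ≟ 1) * w X ≡ ∑[ d ← D ] (μ d * (𝟙 l∈? * (𝟙 (all? (d ∣?_) X) * w X)))
  expand X (no _)    = sym (∑-zero D (λ {d} _ → ℤₚ.*-zeroʳ (μ d)))
  expand X (yes l∈X) = begin
    + 1 * 𝟙 (gcdWith X n ≟ 1) * w X                                 ≡⟨ cong (_* w X) (ℤₚ.*-identityˡ (𝟙 (gcdWith X n ≟ 1))) ⟩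
    𝟙 (gcdWith X n ≟ 1) * w X                                       ≡⟨ cong (_* w X) (𝟙[gcdWith≡1]≡divisorSum X n 1≤n l∈X) ⟩
    ∑[ d ← D ] (𝟙 (d ∣? gcdWith X n) * μ d) * w X                   ≡⟨ ∑-*ʳ D (w X) _ ⟨
    ∑[ d ← D ] (𝟙 (d ∣? gcdWith X n) * μ d * w X)                   ≡⟨ ∑-cong D (λ {d} d∈D → trans
                                                                          (cong (λ a → a * μ d * w X) (∣gcdWith≡all d (proj₁ (∈-divisors⁻ (gcd l n) d∈D))))
                                                                          (shuffle (𝟙 (all? (d ∣?_) X)) (μ d) (w X))) ⟩
    ∑[ d ← D ] (μ d * (+ 1 * (𝟙 (all? (d ∣?_) X) * w X)))          ∎
    where
    ∣gcdWith≡all : ∀ d → d ∣ gcd l n → 𝟙 (d ∣? gcdWith X n) ≡ 𝟙 (all? (d ∣?_) X)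
    ∣gcdWith≡all d d∣g = 𝟙-cong (d ∣? gcdWith X n) (all? (d ∣?_) X) (∣gcdWith⇒All∣ X n)
                                 (gcdWith-greatest X n (∣-trans d∣g (gcd[m,n]∣n l n)))
    shuffle : ∀ a m v → a * m * v ≡ m * (+ 1 * (a * v))
    shuffle = solve-∀

-- Sums over sublists

∑-sublists-∷ : ∀ (a : A) xs (f : List A → ℤ) →
               ∑ (sublists (a ∷ xs)) f ≡ ∑ (sublists xs) f +ℤ ∑[ X ← sublists xs ] f (a ∷ X)
∑-sublists-∷ a xs f = trans (∑-++ (sublists xs) _ f) (cong (∑ (sublists xs) f +ℤ_) (∑-map (sublists xs) (a ∷_) f))

∈-sublists⇒⊆ : ∀ {X} {y : A} xs → X ∈ sublists xs → y ∈ X → y ∈ xs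
∈-sublists⇒⊆ []       (here refl) ()
∈-sublists⇒⊆ (a ∷ xs) X∈ y∈X with ∈-++⁻ (sublists xs) X∈
... | inj₁ X∈′ = there (∈-sublists⇒⊆ xs X∈′ y∈X)
... | inj₂ X∈′ with X′ , X′∈ , refl ← ∈-map⁻ (a ∷_) X∈′ with y∈X
...   | here refl = here refl
...   | there y∈X′ = there (∈-sublists⇒⊆ xs X′∈ y∈X′)

module _ {P : Pred A 0ℓ} (P? : Decidable P) where

  𝟙-all?-∷ : ∀ a X → 𝟙 (all? P? (a ∷ X)) ≡ 𝟙 (P? a) * 𝟙 (all? P? X)
  𝟙-all?-∷ a X with P? a | all? P? X
  ... | yes _ | yes _ = refl
  ... | yes _ | no _  = refl
  ... | no _  | _     = refl

  sublistSum : List A → (ℕ → ℤ) → ℤ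
  sublistSum xs f = ∑[ X ← sublists xs ] (𝟙 (all? P? X) * f (length X))

  sublistSum-∷ : ∀ a xs f → sublistSum (a ∷ xs) f ≡ sublistSum xs f +ℤ 𝟙 (P? a) * sublistSum xs (f ∘ suc)
  sublistSum-∷ a xs f = trans (∑-sublists-∷ a xs (λ X → 𝟙 (all? P? X) * f (length X))) (cong (sublistSum xs f +ℤ_)
    (trans (∑-cong (sublists xs) (λ {X} _ → trans (cong (_* f (suc (length X))) (𝟙-all?-∷ a X))
                                                 (ℤₚ.*-assoc (𝟙 (P? a)) _ _)))
           (∑-*ˡ (sublists xs) (𝟙 (P? a)) _)))

  sublistSum-∷-yes : ∀ {a} xs f → P a → sublistSum (a ∷ xs) f ≡ sublistSum xs f +ℤ sublistSum xs (f ∘ suc)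
  sublistSum-∷-yes {a} xs f Pa = trans (sublistSum-∷ a xs f)
    (cong (sublistSum xs f +ℤ_) (trans (cong (_* sublistSum xs (f ∘ suc)) (𝟙-yes (P? a) Pa)) (ℤₚ.*-identityˡ _)))

  sublistSum-∷-no : ∀ {a} xs f → ¬ P a → sublistSum (a ∷ xs) f ≡ sublistSum xs f
  sublistSum-∷-no {a} xs f ¬Pa = trans (sublistSum-∷ a xs f)
    (trans (cong (λ z → sublistSum xs f +ℤ z * sublistSum xs (f ∘ suc)) (𝟙-no (P? a) ¬Pa)) (ℤₚ.+-identityʳ _))

  sublistSum-cong : ∀ xs {f g} → (∀ j → f j ≡ g j) → sublistSum xs f ≡ sublistSum xs g
  sublistSum-cong xs f≗g = ∑-cong (sublists xs) (λ {X} _ → cong (𝟙 (all? P? X) *_) (f≗g (length X)))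

  sublistSum-1 : ∀ xs → sublistSum xs (λ _ → + 1) ≡ + 2 ^ length (filter P? xs)
  sublistSum-1 []       = refl
  sublistSum-1 (a ∷ xs) with P? a
  ... | yes Pa = begin
    sublistSum (a ∷ xs) (λ _ → + 1)              ≡⟨ sublistSum-∷-yes xs (λ _ → + 1) Pa ⟩
    S +ℤ S                                       ≡⟨ cong (λ z → z +ℤ z) (sublistSum-1 xs) ⟩
    + 2 ^ c +ℤ + 2 ^ c                           ≡⟨ ℤₚ.pos-+ (2 ^ c) (2 ^ c) ⟨
    + (2 ^ c + 2 ^ c)                            ≡⟨ cong (λ z → + (2 ^ c + z)) (ℕₚ.+-identityʳ (2 ^ c)) ⟨
    + 2 ^ suc c                                  ∎
    where
    open ≡-Reasoning
    S : ℤ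
    S = sublistSum xs (λ _ → + 1)
    c : ℕ
    c = length (filter P? xs)
  ... | no ¬Pa = trans (sublistSum-∷-no xs (λ _ → + 1) ¬Pa) (sublistSum-1 xs)

  sublistSum-𝟙≟ : ∀ xs k → sublistSum xs (λ j → 𝟙 (j ≟ k)) ≡ + (length (filter P? xs) C k)
  sublistSum-𝟙≟ []       zero    = refl
  sublistSum-𝟙≟ []       (suc k) = refl
  sublistSum-𝟙≟ (a ∷ xs) zero with P? a
  ... | yes Pa = trans (sublistSum-∷-yes xs (λ j → 𝟙 (j ≟ 0)) Pa)
                   (cong₂ _+ℤ_ (sublistSum-𝟙≟ xs 0) (∑-zero (sublists xs) (λ {X} _ → ℤₚ.*-zeroʳ (𝟙 (all? P? X)))))
  ... | no ¬Pa = trans (sublistSum-∷-no xs (λ j → 𝟙 (j ≟ 0)) ¬Pa) (sublistSum-𝟙≟ xs 0)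
  sublistSum-𝟙≟ (a ∷ xs) (suc k) with P? a
  ... | yes Pa = begin
    sublistSum (a ∷ xs) (λ j → 𝟙 (j ≟ suc k))                              ≡⟨ sublistSum-∷-yes xs (λ j → 𝟙 (j ≟ suc k)) Pa ⟩
    sublistSum xs (λ j → 𝟙 (j ≟ suc k)) +ℤ sublistSum xs (λ j → 𝟙 (suc j ≟ suc k))
                                                                           ≡⟨ cong (sublistSum xs (λ j → 𝟙 (j ≟ suc k)) +ℤ_)
                                                                                (sublistSum-cong xs (λ j → 𝟙[suc≟suc] j k)) ⟩
    sublistSum xs (λ j → 𝟙 (j ≟ suc k)) +ℤ sublistSum xs (λ j → 𝟙 (j ≟ k)) ≡⟨ cong₂ _+ℤ_ (sublistSum-𝟙≟ xs (suc k)) (sublistSum-𝟙≟ xs k) ⟩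
    + (c C suc k) +ℤ + (c C k)                                             ≡⟨ ℤₚ.pos-+ (c C suc k) (c C k) ⟨
    + (c C suc k + c C k)                                                  ≡⟨ cong +_ (ℕₚ.+-comm (c C suc k) (c C k)) ⟩
    + (c C k + c C suc k)                                                  ≡⟨ cong +_ (nCk+nC[k+1]≡[n+1]C[k+1] c k) ⟩
    + (suc c C suc k)                                                      ∎
    where
    open ≡-Reasoning
    c : ℕ
    c = length (filter P? xs)
  ... | no ¬Pa = trans (sublistSum-∷-no xs (λ j → 𝟙 (j ≟ suc k)) ¬Pa) (sublistSum-𝟙≟ xs (suc k))

module _ {P : Pred ℕ 0ℓ} (P? : Decidable P) {x : ℕ} (Px : P x) where

  private
    T : (ℕ → ℤ) → List ℕ → ℤ
    T f X = 𝟙 (x ∈? X) * (𝟙 (all? P? X) * f (length X))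

  ∑-sublists-∋ : ∀ xs ys → ¬ x ∈ xs → ¬ x ∈ ys → (f : ℕ → ℤ) →
                 ∑[ X ← sublists (xs ++ x ∷ ys) ] (𝟙 (x ∈? X) * (𝟙 (all? P? X) * f (length X)))
                 ≡ sublistSum P? (xs ++ ys) (f ∘ suc)
  ∑-sublists-∋ [] ys _ x∉ys f = begin
    ∑ (sublists (x ∷ ys)) (T f)                                     ≡⟨ ∑-sublists-∷ x ys (T f) ⟩
    ∑ (sublists ys) (T f) +ℤ ∑[ X ← sublists ys ] T f (x ∷ X)        ≡⟨ cong₂ _+ℤ_ (∑-zero (sublists ys) x∉X) (∑-cong (sublists ys) (λ {X} _ → with-x X)) ⟩
    + 0 +ℤ sublistSum P? ys (f ∘ suc)                               ≡⟨ ℤₚ.+-identityˡ _ ⟩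
    sublistSum P? ys (f ∘ suc)                                      ∎
    where
    open ≡-Reasoning
    x∉X : ∀ {X} → X ∈ sublists ys → T f X ≡ + 0
    x∉X {X} X∈ = cong (_* (𝟙 (all? P? X) * f (length X))) (𝟙-no (x ∈? X) (λ x∈X → x∉ys (∈-sublists⇒⊆ ys X∈ x∈X)))
    with-x : ∀ X → T f (x ∷ X) ≡ 𝟙 (all? P? X) * f (suc (length X))
    with-x X = begin
      𝟙 (x ∈? x ∷ X) * (𝟙 (all? P? (x ∷ X)) * f (suc (length X)))   ≡⟨ cong₂ (λ u v → u * (v * f (suc (length X))))
                                                                          (𝟙-yes (x ∈? x ∷ X) (here refl)) (𝟙-all?-∷ P? x X) ⟩
      + 1 * (𝟙 (P? x) * 𝟙 (all? P? X) * f (suc (length X)))         ≡⟨ ℤₚ.*-identityˡ (𝟙 (P? x) * 𝟙 (all? P? X) * f (suc (length X))) ⟩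
      𝟙 (P? x) * 𝟙 (all? P? X) * f (suc (length X))                 ≡⟨ cong (λ u → u * 𝟙 (all? P? X) * f (suc (length X))) (𝟙-yes (P? x) Px) ⟩
      + 1 * 𝟙 (all? P? X) * f (suc (length X))                      ≡⟨ cong (_* f (suc (length X))) (ℤₚ.*-identityˡ (𝟙 (all? P? X))) ⟩
      𝟙 (all? P? X) * f (suc (length X))                            ∎
  ∑-sublists-∋ (y ∷ xs) ys x∉y∷xs x∉ys f = begin
    ∑ (sublists (y ∷ R)) (T f)                                      ≡⟨ ∑-sublists-∷ y R (T f) ⟩
    ∑ (sublists R) (T f) +ℤ ∑[ X ← sublists R ] T f (y ∷ X)          ≡⟨ cong (∑ (sublists R) (T f) +ℤ_)
                                                                         (trans (∑-cong (sublists R) (λ {X} _ → with-y X)) (∑-*ˡ (sublists R) (𝟙 (P? y)) _)) ⟩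
    ∑ (sublists R) (T f) +ℤ 𝟙 (P? y) * ∑ (sublists R) (T (f ∘ suc))  ≡⟨ cong₂ (λ u v → u +ℤ 𝟙 (P? y) * v)
                                                                         (∑-sublists-∋ xs ys x∉xs x∉ys f) (∑-sublists-∋ xs ys x∉xs x∉ys (f ∘ suc)) ⟩
    sublistSum P? (xs ++ ys) (f ∘ suc) +ℤ 𝟙 (P? y) * sublistSum P? (xs ++ ys) (f ∘ suc ∘ suc)
                                                                    ≡⟨ sublistSum-∷ P? y (xs ++ ys) (f ∘ suc) ⟨
    sublistSum P? (y ∷ xs ++ ys) (f ∘ suc)                          ∎
    where
    open ≡-Reasoning
    R : List ℕ
    R = xs ++ x ∷ ys
    x∉xs : ¬ x ∈ xs
    x∉xs x∈xs = x∉y∷xs (there x∈xs)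
    with-y : ∀ X → T f (y ∷ X) ≡ 𝟙 (P? y) * T (f ∘ suc) X
    with-y X = trans (cong₂ (λ u v → u * (v * f (suc (length X))))
                            (𝟙-cong (x ∈? y ∷ X) (x ∈? X) (λ { (here x≡y) → ⊥-elim (x∉y∷xs (here x≡y)) ; (there x∈X) → x∈X }) there)
                            (𝟙-all?-∷ P? y X))
                     (shuffle (𝟙 (x ∈? X)) (𝟙 (P? y)) (𝟙 (all? P? X)) (f (suc (length X))))
      where
      shuffle : ∀ i p a v → i * (p * a * v) ≡ p * (i * (a * v))
      shuffle = solve-∀

-- The ground set [1, m₁] ∪ [l₂, m₂]

ground≡ : ∀ m₁ l₂ m₂ → l₂ ≤ m₂ → ground m₁ l₂ m₂ ≡ segment 1 m₁ ++ l₂ ∷ segment (suc l₂) (m₂ ∸ l₂)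
ground≡ m₁ l₂ m₂ l₂≤m₂ = cong₂ _++_ (interval≡segment 1 m₁)
  (trans (interval≡segment l₂ m₂) (cong (segment l₂) (ℕₚ.+-∸-assoc 1 l₂≤m₂)))

length-filter-∣-ground : ∀ d m₁ l₂ m₂ → 1 ≤ d → l₂ ≤ m₂ →
  length (filter (d ∣?_) (segment 1 m₁ ++ segment (suc l₂) (m₂ ∸ l₂))) ≡ m₁ div d + m₂ div d ∸ l₂ div d
length-filter-∣-ground d@(suc _) m₁ l₂ m₂ _ l₂≤m₂ = begin
  count (segment 1 m₁ ++ I₂)                   ≡⟨ count-++ (segment 1 m₁) I₂ ⟩
  count (segment 1 m₁) + count I₂              ≡⟨ cong (_+ count I₂) (length-filter-∣-segment d m₁) ⟩
  m₁ / d + count I₂                            ≡⟨ cong (λ z → m₁ / d + z) (ℕₚ.m+n∸m≡n (l₂ / d) (count I₂)) ⟨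
  m₁ / d + (l₂ / d + count I₂ ∸ l₂ / d)        ≡⟨ ℕₚ.+-∸-assoc (m₁ / d) (ℕₚ.m≤m+n (l₂ / d) (count I₂)) ⟨
  m₁ / d + (l₂ / d + count I₂) ∸ l₂ / d        ≡⟨ cong (λ z → m₁ / d + z ∸ l₂ / d) m₂/d ⟨
  m₁ / d + m₂ / d ∸ l₂ / d                     ∎
  where
  open ≡-Reasoning
  I₂ : List ℕ
  I₂ = segment (suc l₂) (m₂ ∸ l₂)
  count : List ℕ → ℕ
  count xs = length (filter (d ∣?_) xs)
  count-++ : ∀ xs ys → count (xs ++ ys) ≡ count xs + count ys
  count-++ xs ys = trans (cong length (LP.filter-++ (d ∣?_) xs ys)) (LP.length-++ (filter (d ∣?_) xs))
  m₂/d : m₂ / d ≡ l₂ / d + count I₂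
  m₂/d = begin
    m₂ / d                                     ≡⟨ length-filter-∣-segment d m₂ ⟨
    count (segment 1 m₂)                       ≡⟨ cong (λ j → count (segment 1 j)) (ℕₚ.m+[n∸m]≡n l₂≤m₂) ⟨
    count (segment 1 (l₂ + (m₂ ∸ l₂)))         ≡⟨ cong count (segment-++ 1 l₂ (m₂ ∸ l₂)) ⟩
    count (segment 1 l₂ ++ I₂)                 ≡⟨ count-++ (segment 1 l₂) I₂ ⟩
    count (segment 1 l₂) + count I₂            ≡⟨ cong (_+ count I₂) (length-filter-∣-segment d l₂) ⟩
    l₂ / d + count I₂                          ∎

∑-good-sublists-ground : ∀ m₁ l₂ m₂ n → 1 ≤ n → m₁ < l₂ → l₂ ≤ m₂ → (f : ℕ → ℤ) →
  ∑[ X ← sublists (ground m₁ l₂ m₂) ] (𝟙 (good? l₂ n X) * f (length X))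
  ≡ divisorSum (gcd l₂ n) (λ d → μ d * sublistSum (d ∣?_) (segment 1 m₁ ++ segment (suc l₂) (m₂ ∸ l₂)) (f ∘ suc))
∑-good-sublists-ground m₁ l₂ m₂ n 1≤n m₁<l₂ l₂≤m₂ f =
  trans (∑-good≡divisorSum l₂ n 1≤n (sublists (ground m₁ l₂ m₂)) (f ∘ length))
        (∑-cong (divisors (gcd l₂ n)) (λ {d} d∈ → cong (μ d *_) (trans
          (cong (λ xs → ∑[ X ← sublists xs ] (𝟙 (l₂ ∈? X) * (𝟙 (all? (d ∣?_) X) * f (length X)))) (ground≡ m₁ l₂ m₂ l₂≤m₂))
          (∑-sublists-∋ (d ∣?_) (d∣l₂ d∈) (segment 1 m₁) (segment (suc l₂) (m₂ ∸ l₂)) l₂∉I₁ l₂∉I₂ f))))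
  where
  d∣l₂ : ∀ {d} → d ∈ divisors (gcd l₂ n) → d ∣ l₂
  d∣l₂ d∈ = ∣-trans (proj₁ (∈-divisors⁻ (gcd l₂ n) d∈)) (gcd[m,n]∣m l₂ n)
  l₂∉I₁ : ¬ l₂ ∈ segment 1 m₁
  l₂∉I₁ l₂∈ = ℕₚ.<⇒≱ m₁<l₂ (ℕₚ.≤-pred (proj₂ (∈-segment⁻ 1 m₁ l₂∈)))
  l₂∉I₂ : ¬ l₂ ∈ segment (suc l₂) (m₂ ∸ l₂)
  l₂∉I₂ l₂∈ = ℕₚ.<-irrefl refl (proj₁ (∈-segment⁻ (suc l₂) (m₂ ∸ l₂) l₂∈))

Ψ≡divisorSum : ∀ m₁ l₂ m₂ n → 1 ≤ n → m₁ < l₂ → l₂ ≤ m₂ →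
  + Ψ m₁ l₂ m₂ n ≡ divisorSum (gcd l₂ n) (λ d → μ d * + (2 ^ (m₁ div d + m₂ div d ∸ l₂ div d)))
Ψ≡divisorSum m₁ l₂ m₂ n 1≤n m₁<l₂ l₂≤m₂ = begin
  + Ψ m₁ l₂ m₂ n                                        ≡⟨ length-filter≡∑𝟙 (good? l₂ n) S ⟩
  ∑[ X ← S ] 𝟙 (good? l₂ n X)                           ≡⟨ ∑-cong S (λ {X} _ → sym (ℤₚ.*-identityʳ (𝟙 (good? l₂ n X)))) ⟩
  ∑[ X ← S ] (𝟙 (good? l₂ n X) * + 1)                   ≡⟨ ∑-good-sublists-ground m₁ l₂ m₂ n 1≤n m₁<l₂ l₂≤m₂ (λ _ → + 1) ⟩
  divisorSum (gcd l₂ n) (λ d → μ d * sublistSum (d ∣?_) I (λ _ → + 1))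
                                                        ≡⟨ ∑-cong (divisors (gcd l₂ n)) (λ {d} d∈ → cong (μ d *_)
                                                             (trans (sublistSum-1 (d ∣?_) I) (cong (λ c → + 2 ^ c)
                                                               (length-filter-∣-ground d m₁ l₂ m₂ (proj₂ (∈-divisors⁻ (gcd l₂ n) d∈)) l₂≤m₂)))) ⟩
  divisorSum (gcd l₂ n) (λ d → μ d * + (2 ^ (m₁ div d + m₂ div d ∸ l₂ div d)))
                                                        ∎
  where
  open ≡-Reasoning
  S : List (List ℕ)
  S = sublists (ground m₁ l₂ m₂)
  I : List ℕ
  I = segment 1 m₁ ++ segment (suc l₂) (m₂ ∸ l₂)

Ψk≡divisorSum : ∀ k m₁ l₂ m₂ n → 1 ≤ n → m₁ < l₂ → l₂ ≤ m₂ →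
  + Ψk (suc k) m₁ l₂ m₂ n ≡ divisorSum (gcd l₂ n) (λ d → μ d * + ((m₁ div d + m₂ div d ∸ l₂ div d) C k))
Ψk≡divisorSum k m₁ l₂ m₂ n 1≤n m₁<l₂ l₂≤m₂ = begin
  + Ψk (suc k) m₁ l₂ m₂ n                               ≡⟨ length-filter≡∑𝟙 (goodK? l₂ n (suc k)) S ⟩
  ∑[ X ← S ] 𝟙 (goodK? l₂ n (suc k) X)                  ≡⟨ ∑-cong S (λ {X} _ → 𝟙-× (good? l₂ n X) (length X ≟ suc k)) ⟩
  ∑[ X ← S ] (𝟙 (good? l₂ n X) * 𝟙 (length X ≟ suc k))  ≡⟨ ∑-good-sublists-ground m₁ l₂ m₂ n 1≤n m₁<l₂ l₂≤m₂ (λ j → 𝟙 (j ≟ suc k)) ⟩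
  divisorSum (gcd l₂ n) (λ d → μ d * sublistSum (d ∣?_) I (λ j → 𝟙 (suc j ≟ suc k)))
                                                        ≡⟨ ∑-cong (divisors (gcd l₂ n)) (λ {d} d∈ → cong (μ d *_)
                                                             (trans (sublistSum-cong (d ∣?_) I (λ j → 𝟙[suc≟suc] j k))
                                                             (trans (sublistSum-𝟙≟ (d ∣?_) I k) (cong (λ c → + (c C k))
                                                               (length-filter-∣-ground d m₁ l₂ m₂ (proj₂ (∈-divisors⁻ (gcd l₂ n) d∈)) l₂≤m₂))))) ⟩
  divisorSum (gcd l₂ n) (λ d → μ d * + ((m₁ div d + m₂ div d ∸ l₂ div d) C k))
                                                        ∎
  where
  open ≡-Reasoning
  S : List (List ℕ)
  S = sublists (ground m₁ l₂ m₂)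
  I : List ℕ
  I = segment 1 m₁ ++ segment (suc l₂) (m₂ ∸ l₂)

lemma1 : (m₁ l₂ m₂ n : ℕ) → 1 ≤ m₁ → 1 ≤ l₂ → 1 ≤ m₂ → 1 ≤ n → m₁ < l₂ → l₂ ≤ m₂ →
    (+ (Ψ m₁ l₂ m₂ n) ≡ divisorSum (gcd l₂ n)
        (λ d → μ d * + (2 ^ ((m₁ div d) + (m₂ div d) ∸ (l₂ div d)))))
    × ((k : ℕ) → 1 ≤ k →
        + (Ψk k m₁ l₂ m₂ n) ≡ divisorSum (gcd l₂ n)
          (λ d → μ d * + (((m₁ div d) + (m₂ div d) ∸ (l₂ div d)) C (k ∸ 1))))
lemma1 m₁ l₂ m₂ n _ _ _ 1≤n m₁<l₂ l₂≤m₂ =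
  Ψ≡divisorSum m₁ l₂ m₂ n 1≤n m₁<l₂ l₂≤m₂ ,
  λ { (suc k) _ → Ψk≡divisorSum k m₁ l₂ m₂ n 1≤n m₁<l₂ l₂≤m₂ }
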